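{- Let $F$ be a finite field and $n>2$ an integer. Then the unitary Cayley graph $\mathrm{Cay}(M_n(F), GL_n(F))$ is not a strongly regular graph.
   Context: $M_n(F)$ denotes the algebra of $n\times n$ matrices over $F$ and $GL_n(F)$ the group of invertible matrices in it. The unitary Cayley graph $\mathrm{Cay}(M_n(F),GL_n(F))$ is the graph with vertex set $M_n(F)$ in which $\{A,B\}$ is an edge iff $A-B\in GL_n(F)$. A strongly regular graph with parameters $(v,k,\lambda,\mu)$ is a graph on $v$ vertices in which every vertex has exactly $k$ neighbours, any two adjacent vertices have exactly $\lambda$ common neighbours, and any two distinct non-adjacent vertices have exactly $\mu$ common neighbours. -}

module Defs where

open import Level using (Level; _⊔_; suc)
open import Data.Nat using (ℕ)
open import Data.Fin using (Fin)
import Data.Fin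
import Relation.Nullary
open import Data.Unit.Polymorphic using (⊤)
open import Data.Product using (Σ; ∃; _×_; _,_)
open import Relation.Nullary using (¬_)
open import Relation.Binary.PropositionalEquality using (_≡_)
open import Algebra.Bundles using (CommutativeRing)
open import Relation.Binary.Bundles using (Setoid)

record FiniteField (c ℓ : Level) : Set (Level.suc (c ⊔ ℓ)) where
  field
    commRing : CommutativeRing c ℓ
  open CommutativeRing commRing public
  field
    0≉1     : ¬ (0# ≈ 1#)
    inverse : ∀ x → ¬ (x ≈ 0#) → Σ Carrier λ y → x * y ≈ 1#
    size    : ℕ
    toFin   : Carrier → Fin size
    fromFin : Fin size → Carrier
    toFin-cong   : ∀ {x y} → x ≈ y → toFin x ≡ toFin y
    from∘to      : ∀ x → fromFin (toFin x) ≈ x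
    to∘from      : ∀ i → toFin (fromFin i) ≡ i

module Matrices {c ℓ} (F : FiniteField c ℓ) where
  open FiniteField F

  Σ[_] : (n : ℕ) → (Fin n → Carrier) → Carrier
  Σ[ ℕ.zero  ] f = 0#
  Σ[ ℕ.suc n ] f = f Fin.zero + Σ[ n ] (λ i → f (Fin.suc i))

  Mat : ℕ → Set c
  Mat n = Fin n → Fin n → Carrier

  _≈ₘ_ : ∀ {n} → Mat n → Mat n → Set ℓ
  A ≈ₘ B = ∀ i j → A i j ≈ B i j

  _*ₘ_ : ∀ {n} → Mat n → Mat n → Mat n
  _*ₘ_ {n} A B i j = Σ[ n ] (λ k → A i k * B k j)

  _-ₘ_ : ∀ {n} → Mat n → Mat n → Mat n
  (A -ₘ B) i j = A i j - B i j

  Iₘ : ∀ {n} → Mat n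
  Iₘ i j with i Data.Fin.≟ j
  ... | Relation.Nullary.yes _ = 1#
  ... | Relation.Nullary.no  _ = 0#

  IsInvertible : ∀ {n} → Mat n → Set (c ⊔ ℓ)
  IsInvertible {n} A = Σ (Mat n) λ B → (A *ₘ B) ≈ₘ Iₘ × (B *ₘ A) ≈ₘ Iₘ

  MatSetoid : ℕ → Setoid c ℓ
  MatSetoid n = record
    { Carrier = Mat n
    ; _≈_ = _≈ₘ_
    ; isEquivalence = record
      { refl  = λ i j → refl
      ; sym   = λ p i j → sym (p i j)
      ; trans = λ p q i j → trans (p i j) (q i j)
      }
    }

  CayAdj : ∀ {n} → Mat n → Mat n → Set (c ⊔ ℓ)
  CayAdj A B = IsInvertible (A -ₘ B)

HasSize : ∀ {c ℓ p} (S : Setoid c ℓ) → (Setoid.Carrier S → Set p) → ℕ → Set (c ⊔ ℓ ⊔ p)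
HasSize S P k =
  Σ (Fin k → Carrier) λ f →
    (∀ i → P (f i)) ×
    (∀ i j → f i ≈ f j → i ≡ j) ×
    (∀ x → P x → ∃ λ i → x ≈ f i)
  where open Setoid S

IsStronglyRegular : ∀ {c ℓ e} (S : Setoid c ℓ) → (Setoid.Carrier S → Setoid.Carrier S → Set e) →
                    ℕ → ℕ → ℕ → ℕ → Set (c ⊔ ℓ ⊔ e)
IsStronglyRegular {e = e} S E v k λ' μ =
  HasSize S (λ _ → ⊤ {e}) v ×
  (∀ x → HasSize S (E x) k) ×
  (∀ x y → E x y → HasSize S (λ z → E x z × E y z) λ') ×
  (∀ x y → ¬ (x ≈ y) → ¬ (E x y) → HasSize S (λ z → E x z × E y z) μ)
  where open Setoid S

module Submission where

-- Let A₁ = E₀₁ and A₂ = E₀₁ + E₁₂ (indices from 0).  Both are nonzero and singular, hence not adjacent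
-- to 0, so in a strongly regular graph the common neighbours of 0 and A₁ and of 0 and A₂ would be
-- equally many.  A common neighbour of 0 and A is -M with M invertible, say M⁻¹ = Y, and M + A
-- invertible.  For A₁ this holds as soon as 1 + Y₁₀ ≠ 0 (Sherman–Morrison).  For A₂ it forces
-- D Y = (1 + Y₁₀)(1 + Y₂₁) - Y₁₁Y₂₀ ≠ 0, since otherwise a combination of rows 1 and 2 of Y is a left
-- null vector of M + A₂.  So a common neighbour of 0 and A₂ with 1 + Y₁₀ ≠ 0 is one of 0 and A₁, and
-- one with 1 + Y₁₀ = 0 becomes one after a column shear of Y, which keeps Y₁₁ ≠ 0; this map is
-- injective.  It misses the common neighbour -Y₀⁻¹ of 0 and A₁ where Y₀ = (I + E₁₂)(I - E₂₁), since
-- D Y₀ = 0 = (Y₀)₁₁.  Hence the first count is strictly smaller than the second.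

open import Defs
open import Data.Nat using (ℕ; _>_)
open import Data.Product using (∃)
open import Relation.Nullary using (¬_)

open import Algebra.Bundles using (CommutativeRing; RawRing)
open import Algebra.Solver.Ring.AlmostCommutativeRing using (fromCommutativeRing; _-Raw-AlmostCommutative⟶_)
import Algebra.Solver.Ring as RingSolver
open import Data.Fin as Fin using (Fin; zero; suc)
open import Data.Fin.Patterns using (0F; 1F; 2F)
open import Data.Fin.Properties using (suc-injective; injective⇒≤)
open import Data.Integer as ℤ using (ℤ; +_; -[1+_]; _⊖_; _◃_; sign; ∣_∣)
import Data.Integer.Properties as ℤ
open import Data.Maybe using (Maybe; just; nothing)
open import Data.Nat as ℕ using (zero; suc; _<_; s≤s)
import Data.Nat.Properties as ℕ
open import Data.Product using (∃₂; _×_; _,_; proj₁; proj₂)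
open import Data.Sign as Sign using (Sign)
open import Data.Sum using (_⊎_; inj₁; inj₂; [_,_]′)
open import Function using (_∘_)
open import Level using (_⊔_)
open import Relation.Binary.Bundles using (Setoid)
open import Relation.Binary.Definitions using (Decidable)
open import Relation.Binary.PropositionalEquality as ≡ using (_≡_; _≢_)
open import Relation.Nullary using (yes; no; contradiction)
open import Relation.Nullary.Decidable using (map′)

-- The library instantiates Algebra.Solver.Ring only with natural-number coefficients, which cannot
-- express subtraction.
module IntegerCoefficients {c ℓ} (R : CommutativeRing c ℓ) where
  open CommutativeRing R
  open import Algebra.Properties.Ring ring
    using (-‿involutive; -‿distribˡ-*; -‿distribʳ-*; -‿anti-homo-+; -0#≈0#)
  open import Algebra.Properties.Semiring.Mult.TCOptimised semiring
    using (1+×; ×-homo-+; ×1-homo-*) renaming (_×_ to _×ₙ_)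
  open import Algebra.Properties.AbelianGroup +-abelianGroup using (xyx⁻¹≈y)
  open import Relation.Binary.Reasoning.Setoid setoid

  signed : Sign → Carrier → Carrier
  signed Sign.+ x = x
  signed Sign.- x = - x

  signed-cong : ∀ s {x y} → x ≈ y → signed s x ≈ signed s y
  signed-cong Sign.+ x≈y = x≈y
  signed-cong Sign.- x≈y = -‿cong x≈y

  signed-* : ∀ s t x y → signed (s Sign.* t) (x * y) ≈ signed s x * signed t y
  signed-* Sign.+ Sign.+ x y = refl
  signed-* Sign.+ Sign.- x y = -‿distribʳ-* x y
  signed-* Sign.- Sign.+ x y = -‿distribˡ-* x y
  signed-* Sign.- Sign.- x y = begin
    x * y           ≈⟨ -‿involutive (x * y) ⟨
    - (- (x * y))   ≈⟨ -‿cong (-‿distribˡ-* x y) ⟩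
    - (- x * y)     ≈⟨ -‿distribʳ-* (- x) y ⟩
    - x * - y       ∎

  -- With the type-checking-optimised _×ₙ_, fromℤ (+ 1) reduces to 1#, so solver constants match goals.
  fromℤ : ℤ → Carrier
  fromℤ (+ n)      = n ×ₙ 1#
  fromℤ (-[1+ n ]) = - (suc n ×ₙ 1#)

  fromℤ-◃ : ∀ s n → fromℤ (s ◃ n) ≈ signed s (n ×ₙ 1#)
  fromℤ-◃ Sign.+ zero    = refl
  fromℤ-◃ Sign.- zero    = sym -0#≈0#
  fromℤ-◃ Sign.+ (suc n) = refl
  fromℤ-◃ Sign.- (suc n) = refl

  fromℤ-signAbs : ∀ i → fromℤ i ≈ signed (sign i) (∣ i ∣ ×ₙ 1#)
  fromℤ-signAbs (+ n)    = refl
  fromℤ-signAbs -[1+ n ] = refl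

  fromℤ-homo-* : ∀ i j → fromℤ (i ℤ.* j) ≈ fromℤ i * fromℤ j
  fromℤ-homo-* i j = begin
    fromℤ (s ◃ ∣ i ∣ ℕ.* ∣ j ∣)                                     ≈⟨ fromℤ-◃ s (∣ i ∣ ℕ.* ∣ j ∣) ⟩
    signed s ((∣ i ∣ ℕ.* ∣ j ∣) ×ₙ 1#)                              ≈⟨ signed-cong s (×1-homo-* ∣ i ∣ ∣ j ∣) ⟩
    signed s ((∣ i ∣ ×ₙ 1#) * (∣ j ∣ ×ₙ 1#))                        ≈⟨ signed-* (sign i) (sign j) _ _ ⟩
    signed (sign i) (∣ i ∣ ×ₙ 1#) * signed (sign j) (∣ j ∣ ×ₙ 1#)  ≈⟨ *-cong (fromℤ-signAbs i) (fromℤ-signAbs j) ⟨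
    fromℤ i * fromℤ j                                               ∎
    where s = sign i Sign.* sign j

  fromℤ-⊖ : ∀ m n → fromℤ (m ⊖ n) ≈ m ×ₙ 1# - n ×ₙ 1#
  fromℤ-⊖ zero    zero    = sym (-‿inverseʳ 0#)
  fromℤ-⊖ zero    (suc n) = sym (+-identityˡ _)
  fromℤ-⊖ (suc m) zero    = sym (trans (+-congˡ -0#≈0#) (+-identityʳ _))
  fromℤ-⊖ (suc m) (suc n) = begin
    fromℤ (suc m ⊖ suc n)              ≡⟨ ≡.cong fromℤ (ℤ.[1+m]⊖[1+n]≡m⊖n m n) ⟩
    fromℤ (m ⊖ n)                      ≈⟨ fromℤ-⊖ m n ⟩
    m ×ₙ 1# - n ×ₙ 1#                  ≈⟨ 1+-cancel (m ×ₙ 1#) (n ×ₙ 1#) ⟨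
    (1# + m ×ₙ 1#) - (1# + n ×ₙ 1#)    ≈⟨ +-cong (1+× m 1#) (-‿cong (1+× n 1#)) ⟨
    suc m ×ₙ 1# - suc n ×ₙ 1#          ∎
    where
    1+-cancel : ∀ a b → (1# + a) - (1# + b) ≈ a - b
    1+-cancel a b = begin
      (1# + a) - (1# + b)   ≈⟨ +-congˡ (-‿anti-homo-+ 1# b) ⟩
      (1# + a) + (- b - 1#) ≈⟨ +-assoc _ _ _ ⟨
      (1# + a) - b - 1#     ≈⟨ +-congʳ (+-assoc 1# a (- b)) ⟩
      1# + (a - b) - 1#     ≈⟨ xyx⁻¹≈y 1# (a - b) ⟩
      a - b                 ∎

  fromℤ-homo-+ : ∀ i j → fromℤ (i ℤ.+ j) ≈ fromℤ i + fromℤ j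
  fromℤ-homo-+ (+ m)    (+ n)    = ×-homo-+ 1# m n
  fromℤ-homo-+ (+ m)    -[1+ n ] = fromℤ-⊖ m (suc n)
  fromℤ-homo-+ -[1+ m ] (+ n)    = trans (fromℤ-⊖ n (suc m)) (+-comm _ _)
  fromℤ-homo-+ -[1+ m ] -[1+ n ] = begin
    - (suc (suc (m ℕ.+ n)) ×ₙ 1#)   ≡⟨ ≡.cong (λ k → - (suc k ×ₙ 1#)) (ℕ.+-suc m n) ⟨
    - ((suc m ℕ.+ suc n) ×ₙ 1#)     ≈⟨ -‿cong (×-homo-+ 1# (suc m) (suc n)) ⟩
    - (suc m ×ₙ 1# + suc n ×ₙ 1#)   ≈⟨ -‿anti-homo-+ _ _ ⟩
    - (suc n ×ₙ 1#) - suc m ×ₙ 1#   ≈⟨ +-comm _ _ ⟩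
    - (suc m ×ₙ 1#) - suc n ×ₙ 1#   ∎

  fromℤ-homo-neg : ∀ i → fromℤ (ℤ.- i) ≈ - fromℤ i
  fromℤ-homo-neg (+ zero)  = sym -0#≈0#
  fromℤ-homo-neg (+ suc n) = refl
  fromℤ-homo-neg -[1+ n ]  = sym (-‿involutive _)

  ℤ-rawRing : RawRing _ _
  ℤ-rawRing = record
    { Carrier = ℤ ; _≈_ = _≡_ ; _+_ = ℤ._+_ ; _*_ = ℤ._*_ ; -_ = ℤ.-_ ; 0# = + 0 ; 1# = + 1 }

  ℤ-homomorphism : ℤ-rawRing -Raw-AlmostCommutative⟶ fromCommutativeRing R
  ℤ-homomorphism = record
    { ⟦_⟧ = fromℤ ; +-homo = fromℤ-homo-+ ; *-homo = fromℤ-homo-* ; -‿homo = fromℤ-homo-neg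
    ; 0-homo = refl ; 1-homo = refl }

  fromℤ-≟ : ∀ i j → Maybe (fromℤ i ≈ fromℤ j)
  fromℤ-≟ i j with i ℤ.≟ j
  ... | yes ≡.refl = just refl
  ... | no _       = nothing

  open RingSolver ℤ-rawRing (fromCommutativeRing R) ℤ-homomorphism fromℤ-≟ public

module _ {c ℓ} (S : Setoid c ℓ) where
  open Setoid S

  HasSize-<-byInjection : ∀ {p q} {P : Carrier → Set p} {Q : Carrier → Set q} {k l} →
    HasSize S P k → HasSize S Q l →
    (f : ∀ x → P x → Carrier) → (∀ x Px → Q (f x Px)) →
    (∀ x y Px Py → f x Px ≈ f y Py → x ≈ y) →
    ∀ z → Q z → (∀ x Px → ¬ f x Px ≈ z) → k < l
  HasSize-<-byInjection {Q = Q} {k} {l} (g , gP , g-injective , _) (h , _ , _ , h-onto) f fQ f-injective z Qz z∉f =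
    injective⇒≤ embed-injective
    where
    index : ∀ x → Q x → Fin l
    index x Qx = proj₁ (h-onto x Qx)
    index-injective : ∀ {x y} Qx Qy → index x Qx ≡ index y Qy → x ≈ y
    index-injective {x} {y} Qx Qy eq =
      trans (proj₂ (h-onto x Qx)) (trans (reflexive (≡.cong h eq)) (sym (proj₂ (h-onto y Qy))))
    embed : Fin (ℕ.suc k) → Fin l
    embed zero    = index z Qz
    embed (suc i) = index (f (g i) (gP i)) (fQ _ _)
    embed-injective : ∀ {i j} → embed i ≡ embed j → i ≡ j
    embed-injective {zero}  {zero}  _  = ≡.refl
    embed-injective {zero}  {suc j} eq = contradiction (sym (index-injective _ _ eq)) (z∉f _ _)
    embed-injective {suc i} {zero}  eq = contradiction (index-injective _ _ eq) (z∉f _ _)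
    embed-injective {suc i} {suc j} eq =
      ≡.cong suc (g-injective i j (f-injective _ _ _ _ (index-injective _ _ eq)))

module MatrixAlgebra {c ℓ} (F : FiniteField c ℓ) where
  open FiniteField F hiding (zero)
  open Matrices F
  open IntegerCoefficients commRing
  open import Algebra.Properties.Ring ring using (-‿involutive; -0#≈0#)
  open import Relation.Binary.Reasoning.Setoid setoid
  open module MatSetoid′ {n} = Setoid (MatSetoid n) public using ()
    renaming (refl to ≈ₘ-refl; sym to ≈ₘ-sym; trans to ≈ₘ-trans)

  toFin-injective : ∀ {x y} → toFin x ≡ toFin y → x ≈ y
  toFin-injective {x} {y} eq = trans (sym (from∘to x)) (trans (reflexive (≡.cong fromFin eq)) (from∘to y))

  infix 4 _≟_
  _≟_ : Decidable _≈_
  x ≟ y = map′ toFin-injective toFin-cong (toFin x Fin.≟ toFin y)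

  *-cancelʳ-nonZero : ∀ {x y z} → ¬ z ≈ 0# → x * z ≈ y * z → x ≈ y
  *-cancelʳ-nonZero {x} {y} {z} z≉0 xz≈yz with inverse z z≉0
  ... | z⁻¹ , zz⁻¹≈1 = begin
    x               ≈⟨ *-identityʳ x ⟨
    x * 1#          ≈⟨ *-congˡ zz⁻¹≈1 ⟨
    x * (z * z⁻¹)   ≈⟨ *-assoc x z z⁻¹ ⟨
    x * z * z⁻¹     ≈⟨ *-congʳ xz≈yz ⟩
    y * z * z⁻¹     ≈⟨ *-assoc y z z⁻¹ ⟩
    y * (z * z⁻¹)   ≈⟨ *-congˡ zz⁻¹≈1 ⟩
    y * 1#          ≈⟨ *-identityʳ y ⟩
    y               ∎

  -‿nonZero : ∀ {x} → ¬ x ≈ 0# → ¬ - x ≈ 0#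
  -‿nonZero x≉0 -x≈0 = x≉0 (trans (sym (-‿involutive _)) (trans (-‿cong -x≈0) -0#≈0#))

  Σ-cong : ∀ n {f g : Fin n → Carrier} → (∀ k → f k ≈ g k) → Σ[ n ] f ≈ Σ[ n ] g
  Σ-cong zero    f≈g = refl
  Σ-cong (suc n) f≈g = +-cong (f≈g zero) (Σ-cong n (λ k → f≈g (suc k)))

  Σ-zero : ∀ n {f : Fin n → Carrier} → (∀ k → f k ≈ 0#) → Σ[ n ] f ≈ 0#
  Σ-zero zero    f≈0 = refl
  Σ-zero (suc n) f≈0 = trans (+-cong (f≈0 zero) (Σ-zero n (λ k → f≈0 (suc k)))) (+-identityʳ 0#)

  Σ-distrib-+ : ∀ n (f g : Fin n → Carrier) → Σ[ n ] (λ k → f k + g k) ≈ Σ[ n ] f + Σ[ n ] g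
  Σ-distrib-+ zero    f g = sym (+-identityʳ 0#)
  Σ-distrib-+ (suc n) f g = trans (+-congˡ (Σ-distrib-+ n (λ k → f (suc k)) (λ k → g (suc k))))
    (solve 4 (λ a b x y → (a :+ b) :+ (x :+ y) := (a :+ x) :+ (b :+ y)) refl _ _ _ _)

  Σ-factorˡ : ∀ n a (f : Fin n → Carrier) → Σ[ n ] (λ k → a * f k) ≈ a * Σ[ n ] f
  Σ-factorˡ zero    a f = sym (zeroʳ a)
  Σ-factorˡ (suc n) a f = trans (+-congˡ (Σ-factorˡ n a (λ k → f (suc k)))) (sym (distribˡ _ _ _))

  Σ-linear₂ : ∀ n a b (f g : Fin n → Carrier) →
    Σ[ n ] (λ k → a * f k + b * g k) ≈ a * Σ[ n ] f + b * Σ[ n ] g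
  Σ-linear₂ n a b f g = trans (Σ-distrib-+ n _ _) (+-cong (Σ-factorˡ n a f) (Σ-factorˡ n b g))

  Σ-linear₄ : ∀ n a b c d (f g h l : Fin n → Carrier) →
    Σ[ n ] (λ k → (a * f k + b * g k) + (c * h k + d * l k)) ≈
    (a * Σ[ n ] f + b * Σ[ n ] g) + (c * Σ[ n ] h + d * Σ[ n ] l)
  Σ-linear₄ n a b c d f g h l = trans (Σ-distrib-+ n _ _) (+-cong (Σ-linear₂ n a b f g) (Σ-linear₂ n c d h l))

  Σ-comm : ∀ n m (f : Fin n → Fin m → Carrier) →
    Σ[ n ] (λ i → Σ[ m ] (λ j → f i j)) ≈ Σ[ m ] (λ j → Σ[ n ] (λ i → f i j))
  Σ-comm zero    m f = sym (Σ-zero m (λ _ → refl))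
  Σ-comm (suc n) m f = trans (+-congˡ (Σ-comm n m (λ i → f (suc i)))) (sym (Σ-distrib-+ m _ _))

  Σ-select : ∀ n a (f : Fin n → Carrier) → (∀ k → k ≢ a → f k ≈ 0#) → Σ[ n ] f ≈ f a
  Σ-select (suc n) zero    f f≈0 = trans (+-congˡ (Σ-zero n (λ k → f≈0 (suc k) (λ ())))) (+-identityʳ _)
  Σ-select (suc n) (suc a) f f≈0 = trans (+-congʳ (f≈0 zero (λ ()))) (trans (+-identityˡ _)
    (Σ-select n a (λ k → f (suc k)) (λ k k≢a → f≈0 (suc k) (k≢a ∘ suc-injective))))

  Iₘ-diagonal : ∀ {n} (i : Fin n) → Iₘ i i ≈ 1#
  Iₘ-diagonal i with i Fin.≟ i
  ... | yes _  = refl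
  ... | no i≢i = contradiction ≡.refl i≢i

  Iₘ-offDiagonal : ∀ {n} {i j : Fin n} → i ≢ j → Iₘ i j ≈ 0#
  Iₘ-offDiagonal {i = i} {j} i≢j with i Fin.≟ j
  ... | yes i≡j = contradiction i≡j i≢j
  ... | no _    = refl

  Iₘ-sym : ∀ {n} (i j : Fin n) → Iₘ i j ≈ Iₘ j i
  Iₘ-sym i j with i Fin.≟ j | j Fin.≟ i
  ... | yes _   | yes _   = refl
  ... | no _    | no _    = refl
  ... | yes i≡j | no j≢i  = contradiction (≡.sym i≡j) j≢i
  ... | no i≢j  | yes j≡i = contradiction (≡.sym j≡i) i≢j

  Σ-Iₘʳ : ∀ n a (f : Fin n → Carrier) → Σ[ n ] (λ k → f k * Iₘ k a) ≈ f a
  Σ-Iₘʳ n a f = trans (Σ-select n a _ (λ k k≢a → trans (*-congˡ (Iₘ-offDiagonal k≢a)) (zeroʳ _)))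
                      (trans (*-congˡ (Iₘ-diagonal a)) (*-identityʳ _))

  Σ-Iₘˡ : ∀ n a (f : Fin n → Carrier) → Σ[ n ] (λ k → Iₘ a k * f k) ≈ f a
  Σ-Iₘˡ n a f = trans (Σ-cong n (λ k → trans (*-comm _ _) (*-congˡ (Iₘ-sym a k)))) (Σ-Iₘʳ n a f)

  rowVector-*ₘ-assoc : ∀ {n} (w : Fin n → Carrier) (A B : Mat n) j →
    Σ[ n ] (λ l → Σ[ n ] (λ k → w k * A k l) * B l j) ≈ Σ[ n ] (λ k → w k * (A *ₘ B) k j)
  rowVector-*ₘ-assoc {n} w A B j = begin
    Σ[ n ] (λ l → Σ[ n ] (λ k → w k * A k l) * B l j)
      ≈⟨ Σ-cong n (λ l → trans (*-comm _ _) (trans (sym (Σ-factorˡ n _ _))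
           (Σ-cong n (λ k → solve 3 (λ b w a → b :* (w :* a) := w :* (a :* b)) refl _ _ _)))) ⟩
    Σ[ n ] (λ l → Σ[ n ] (λ k → w k * (A k l * B l j)))  ≈⟨ Σ-comm n n _ ⟩
    Σ[ n ] (λ k → Σ[ n ] (λ l → w k * (A k l * B l j)))  ≈⟨ Σ-cong n (λ k → Σ-factorˡ n _ _) ⟩
    Σ[ n ] (λ k → w k * (A *ₘ B) k j)                    ∎

  *ₘ-assoc : ∀ {n} (A B C : Mat n) → ((A *ₘ B) *ₘ C) ≈ₘ (A *ₘ (B *ₘ C))
  *ₘ-assoc A B C i = rowVector-*ₘ-assoc (A i) B C

  *ₘ-cong : ∀ {n} {A A′ B B′ : Mat n} → A ≈ₘ A′ → B ≈ₘ B′ → (A *ₘ B) ≈ₘ (A′ *ₘ B′)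
  *ₘ-cong {n} A≈A′ B≈B′ i j = Σ-cong n (λ k → *-cong (A≈A′ i k) (B≈B′ k j))

  *ₘ-identityˡ : ∀ {n} (A : Mat n) → (Iₘ *ₘ A) ≈ₘ A
  *ₘ-identityˡ {n} A i j = Σ-Iₘˡ n i (λ k → A k j)

  *ₘ-identityʳ : ∀ {n} (A : Mat n) → (A *ₘ Iₘ) ≈ₘ A
  *ₘ-identityʳ {n} A i j = Σ-Iₘʳ n j (A i)

  inverse-unique : ∀ {n} {N N′ Y Y′ : Mat n} → N ≈ₘ N′ → (N *ₘ Y) ≈ₘ Iₘ → (Y′ *ₘ N′) ≈ₘ Iₘ → Y ≈ₘ Y′
  inverse-unique {N = N} {N′} {Y} {Y′} N≈N′ NY≈I Y′N′≈I =
    ≈ₘ-trans (≈ₘ-sym (*ₘ-identityˡ Y))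
    (≈ₘ-trans (*ₘ-cong (≈ₘ-sym (≈ₘ-trans (*ₘ-cong ≈ₘ-refl N≈N′) Y′N′≈I)) ≈ₘ-refl)
    (≈ₘ-trans (*ₘ-assoc Y′ N Y) (≈ₘ-trans (*ₘ-cong ≈ₘ-refl NY≈I) (*ₘ-identityʳ Y′))))

  IsInvertible-resp : ∀ {n} {N N′ : Mat n} → N ≈ₘ N′ → IsInvertible N → IsInvertible N′
  IsInvertible-resp N≈N′ (Y , NY≈I , YN≈I) =
    Y , ≈ₘ-trans (*ₘ-cong (≈ₘ-sym N≈N′) ≈ₘ-refl) NY≈I , ≈ₘ-trans (*ₘ-cong ≈ₘ-refl (≈ₘ-sym N≈N′)) YN≈I

  leftNull⇒zero : ∀ {n} {N : Mat n} (w : Fin n → Carrier) → IsInvertible N →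
    (∀ l → Σ[ n ] (λ k → w k * N k l) ≈ 0#) → ∀ j → w j ≈ 0#
  leftNull⇒zero {n} {N} w (Y , NY≈I , _) wN≈0 j = begin
    w j                                                ≈⟨ Σ-Iₘʳ n j w ⟨
    Σ[ n ] (λ k → w k * Iₘ k j)                        ≈⟨ Σ-cong n (λ k → *-congˡ (NY≈I k j)) ⟨
    Σ[ n ] (λ k → w k * (N *ₘ Y) k j)                  ≈⟨ rowVector-*ₘ-assoc w N Y j ⟨
    Σ[ n ] (λ l → Σ[ n ] (λ k → w k * N k l) * Y l j)  ≈⟨ Σ-zero n (λ l → trans (*-congʳ (wN≈0 l)) (zeroˡ _)) ⟩
    0#                                                 ∎

  zeroRow⇒singular : ∀ {n} (N : Mat n) r → (∀ j → N r j ≈ 0#) → ¬ IsInvertible N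
  zeroRow⇒singular {n} N r Nr≈0 inv = 0≉1 (begin
    0#      ≈⟨ leftNull⇒zero (Iₘ r) inv (λ l → trans (Σ-Iₘˡ n r (λ k → N k l)) (Nr≈0 l)) r ⟨
    Iₘ r r  ≈⟨ Iₘ-diagonal r ⟩
    1#      ∎)

  0ₘ : ∀ {n} → Mat n
  0ₘ _ _ = 0#

  _+ₘ_ : ∀ {n} → Mat n → Mat n → Mat n
  (A +ₘ B) i j = A i j + B i j

  E : ∀ {n} → Fin n → Fin n → Mat n
  E a b i j = Iₘ i a * Iₘ b j

  0ₘ-ₘ-involutive : ∀ {n} (X : Mat n) → (0ₘ -ₘ (0ₘ -ₘ X)) ≈ₘ X
  0ₘ-ₘ-involutive X i j = solve 1 (λ x → con (+ 0) :- (con (+ 0) :- x) := x) refl (X i j)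

  0ₘ-ₘ-injective : ∀ {n} {X X′ : Mat n} → (0ₘ -ₘ X) ≈ₘ (0ₘ -ₘ X′) → X ≈ₘ X′
  0ₘ-ₘ-injective {X = X} {X′} eq =
    ≈ₘ-trans (≈ₘ-sym (0ₘ-ₘ-involutive X)) (≈ₘ-trans (λ i j → +-congˡ (-‿cong (eq i j))) (0ₘ-ₘ-involutive X′))

  CayAdj⇒invertible : ∀ {n} (A Z : Mat n) → CayAdj A Z → IsInvertible ((0ₘ -ₘ Z) +ₘ A)
  CayAdj⇒invertible A Z = IsInvertible-resp
    (λ i j → solve 2 (λ a z → a :- z := (con (+ 0) :- z) :+ a) refl (A i j) (Z i j))

  invertible⇒CayAdj : ∀ {n} (A M : Mat n) → IsInvertible (M +ₘ A) → CayAdj A (0ₘ -ₘ M)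
  invertible⇒CayAdj A M = IsInvertible-resp
    (λ i j → solve 2 (λ a m → m :+ a := a :- (con (+ 0) :- m)) refl (A i j) (M i j))

  -- rowShear a b s M = (Iₘ - s E a b) M and colShear a b s Y = Y (Iₘ + s E a b).
  rowShear colShear : ∀ {n} → Fin n → Fin n → Carrier → Mat n → Mat n
  rowShear a b s M i j = M i j - Iₘ i a * (s * M b j)
  colShear a b s Y i j = Y i j + Iₘ j b * (s * Y i a)

  shear-inverseʳ : ∀ {n} (a b : Fin n) → a ≢ b → ∀ s (M Y : Mat n) → (M *ₘ Y) ≈ₘ Iₘ →
    (rowShear a b s M *ₘ colShear a b s Y) ≈ₘ Iₘ
  shear-inverseʳ {n} a b a≢b s M Y MY≈I i j = begin
    Σ[ n ] (λ k → (M i k - Iₘ i a * (s * M b k)) * (Y k j + Iₘ j b * (s * Y k a)))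
      ≈⟨ Σ-cong n (λ k → solve 7 (λ Mik Iia s Mbk Ykj Ijb Yka →
           (Mik :- Iia :* (s :* Mbk)) :* (Ykj :+ Ijb :* (s :* Yka)) :=
           (con (+ 1) :* (Mik :* Ykj) :+ (Ijb :* s) :* (Mik :* Yka)) :+
           ((:- (Iia :* s)) :* (Mbk :* Ykj) :+ (:- (Iia :* s :* Ijb :* s)) :* (Mbk :* Yka)))
           refl (M i k) (Iₘ i a) s (M b k) (Y k j) (Iₘ j b) (Y k a)) ⟩
    _ ≈⟨ Σ-linear₄ n 1# (Iₘ j b * s) (- (Iₘ i a * s)) (- (Iₘ i a * s * Iₘ j b * s))
           (λ k → M i k * Y k j) (λ k → M i k * Y k a) (λ k → M b k * Y k j) (λ k → M b k * Y k a) ⟩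
    (1# * (M *ₘ Y) i j + (Iₘ j b * s) * (M *ₘ Y) i a) +
    ((- (Iₘ i a * s)) * (M *ₘ Y) b j + (- (Iₘ i a * s * Iₘ j b * s)) * (M *ₘ Y) b a)
      ≈⟨ +-cong (+-cong (*-congˡ (MY≈I i j)) (*-congˡ (MY≈I i a)))
                (+-cong (*-congˡ (trans (MY≈I b j) (Iₘ-sym b j)))
                        (*-congˡ (trans (MY≈I b a) (Iₘ-offDiagonal (a≢b ∘ ≡.sym))))) ⟩
    (1# * Iₘ i j + (Iₘ j b * s) * Iₘ i a) + ((- (Iₘ i a * s)) * Iₘ j b + (- (Iₘ i a * s * Iₘ j b * s)) * 0#)
      ≈⟨ solve 4 (λ Iij Ijb s Iia → (con (+ 1) :* Iij :+ (Ijb :* s) :* Iia) :+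
           ((:- (Iia :* s)) :* Ijb :+ (:- (Iia :* s :* Ijb :* s)) :* con (+ 0)) := Iij)
           refl (Iₘ i j) (Iₘ j b) s (Iₘ i a) ⟩
    Iₘ i j ∎

  shear-inverseˡ : ∀ {n} (a b : Fin n) → a ≢ b → ∀ s (M Y : Mat n) → (Y *ₘ M) ≈ₘ Iₘ →
    (colShear a b s Y *ₘ rowShear a b s M) ≈ₘ Iₘ
  shear-inverseˡ {n} a b a≢b s M Y YM≈I i j = begin
    Σ[ n ] (λ k → (Y i k + Iₘ k b * (s * Y i a)) * (M k j - Iₘ k a * (s * M b j)))
      ≈⟨ Σ-cong n (λ k → solve 7 (λ Yik Ikb s Yia Mkj Ika Mbj →
           (Yik :+ Ikb :* (s :* Yia)) :* (Mkj :- Ika :* (s :* Mbj)) :=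
           (con (+ 1) :* (Yik :* Mkj) :+ (s :* Yia) :* (Mkj :* Ikb)) :+
           ((:- (s :* Mbj)) :* (Yik :* Ika) :+ (:- (s :* Yia :* s :* Mbj)) :* (Ika :* Ikb)))
           refl (Y i k) (Iₘ k b) s (Y i a) (M k j) (Iₘ k a) (M b j)) ⟩
    _ ≈⟨ Σ-linear₄ n 1# (s * Y i a) (- (s * M b j)) (- (s * Y i a * s * M b j))
           (λ k → Y i k * M k j) (λ k → M k j * Iₘ k b) (λ k → Y i k * Iₘ k a) (λ k → Iₘ k a * Iₘ k b) ⟩
    (1# * (Y *ₘ M) i j + (s * Y i a) * Σ[ n ] (λ k → M k j * Iₘ k b)) +
    ((- (s * M b j)) * Σ[ n ] (λ k → Y i k * Iₘ k a) + (- (s * Y i a * s * M b j)) * Σ[ n ] (λ k → Iₘ k a * Iₘ k b))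
      ≈⟨ +-cong (+-cong (*-congˡ (YM≈I i j)) (*-congˡ (Σ-Iₘʳ n b (λ k → M k j))))
                (+-cong (*-congˡ (Σ-Iₘʳ n a (Y i)))
                        (*-congˡ (trans (Σ-Iₘʳ n b (λ k → Iₘ k a)) (Iₘ-offDiagonal (a≢b ∘ ≡.sym))))) ⟩
    (1# * Iₘ i j + (s * Y i a) * M b j) + ((- (s * M b j)) * Y i a + (- (s * Y i a * s * M b j)) * 0#)
      ≈⟨ solve 4 (λ Iij s Yia Mbj → (con (+ 1) :* Iij :+ (s :* Yia) :* Mbj) :+
           ((:- (s :* Mbj)) :* Yia :+ (:- (s :* Yia :* s :* Mbj)) :* con (+ 0)) := Iij)
           refl (Iₘ i j) s (Y i a) (M b j) ⟩
    Iₘ i j ∎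

  shear-inverse : ∀ {n} (a b : Fin n) → a ≢ b → ∀ s (M Y : Mat n) → (M *ₘ Y) ≈ₘ Iₘ → (Y *ₘ M) ≈ₘ Iₘ →
    (rowShear a b s M *ₘ colShear a b s Y) ≈ₘ Iₘ × (colShear a b s Y *ₘ rowShear a b s M) ≈ₘ Iₘ
  shear-inverse a b a≢b s M Y MY≈I YM≈I = shear-inverseʳ a b a≢b s M Y MY≈I , shear-inverseˡ a b a≢b s M Y YM≈I

  colShear-≢ : ∀ {n} (a b : Fin n) s (Y : Mat n) k l → l ≢ b → colShear a b s Y k l ≈ Y k l
  colShear-≢ a b s Y k l l≢b = trans (+-congˡ (trans (*-congʳ (Iₘ-offDiagonal l≢b)) (zeroˡ _))) (+-identityʳ _)

  colShear-target : ∀ {n} (a b : Fin n) s (Y : Mat n) k → colShear a b s Y k b ≈ Y k b + s * Y k a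
  colShear-target a b s Y k = +-congˡ (trans (*-congʳ (Iₘ-diagonal b)) (*-identityˡ _))

  colShear-cong : ∀ {n} {a b : Fin n} {s s′} {Y Y′ : Mat n} → s ≈ s′ → Y ≈ₘ Y′ →
    colShear a b s Y ≈ₘ colShear a b s′ Y′
  colShear-cong {a = a} s≈s′ Y≈Y′ k l = +-cong (Y≈Y′ k l) (*-congˡ (*-cong s≈s′ (Y≈Y′ k a)))

  colShear-cancel : ∀ {n} {a b : Fin n} → a ≢ b → ∀ s (Y : Mat n) → colShear a b (- s) (colShear a b s Y) ≈ₘ Y
  colShear-cancel {a = a} {b} a≢b s Y k l = begin
    colShear a b s Y k l + Iₘ l b * (- s * colShear a b s Y k a)
      ≈⟨ +-congˡ (*-congˡ (*-congˡ (colShear-≢ a b s Y k a a≢b))) ⟩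
    Y k l + Iₘ l b * (s * Y k a) + Iₘ l b * (- s * Y k a)
      ≈⟨ solve 4 (λ y i s x → y :+ i :* (s :* x) :+ i :* (:- s :* x) := y) refl (Y k l) (Iₘ l b) s (Y k a) ⟩
    Y k l ∎

  -- Sherman–Morrison: if Y = M⁻¹ and t (1 + Y b a) ≈ 1 then (M + E a b)⁻¹ = Y - t Y E a b Y.
  rankOneInverse : ∀ {n} → Mat n → Fin n → Fin n → Carrier → Mat n
  rankOneInverse Y a b t i j = Y i j - t * (Y i a * Y b j)

  rankOne-inverseʳ : ∀ {n} (M Y : Mat n) a b t → (M *ₘ Y) ≈ₘ Iₘ → t * (1# + Y b a) ≈ 1# →
    ((M +ₘ E a b) *ₘ rankOneInverse Y a b t) ≈ₘ Iₘ
  rankOne-inverseʳ {n} M Y a b t MY≈I t[1+Yba]≈1 i j = begin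
    Σ[ n ] (λ k → (M i k + Iₘ i a * Iₘ b k) * (Y k j - t * (Y k a * Y b j)))
      ≈⟨ Σ-cong n (λ k → solve 7 (λ Mik Iia Ibk Ykj t Yka Ybj →
           (Mik :+ Iia :* Ibk) :* (Ykj :- t :* (Yka :* Ybj)) :=
           (con (+ 1) :* (Mik :* Ykj) :+ (:- (t :* Ybj)) :* (Mik :* Yka)) :+
           (Iia :* (Ibk :* Ykj) :+ (:- (Iia :* (t :* Ybj))) :* (Ibk :* Yka)))
           refl (M i k) (Iₘ i a) (Iₘ b k) (Y k j) t (Y k a) (Y b j)) ⟩
    _ ≈⟨ Σ-linear₄ n 1# (- (t * Y b j)) (Iₘ i a) (- (Iₘ i a * (t * Y b j)))
           (λ k → M i k * Y k j) (λ k → M i k * Y k a) (λ k → Iₘ b k * Y k j) (λ k → Iₘ b k * Y k a) ⟩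
    (1# * (M *ₘ Y) i j + (- (t * Y b j)) * (M *ₘ Y) i a) +
    (Iₘ i a * Σ[ n ] (λ k → Iₘ b k * Y k j) + (- (Iₘ i a * (t * Y b j))) * Σ[ n ] (λ k → Iₘ b k * Y k a))
      ≈⟨ +-cong (+-cong (*-congˡ (MY≈I i j)) (*-congˡ (MY≈I i a)))
                (+-cong (*-congˡ (Σ-Iₘˡ n b (λ k → Y k j))) (*-congˡ (Σ-Iₘˡ n b (λ k → Y k a)))) ⟩
    (1# * Iₘ i j + (- (t * Y b j)) * Iₘ i a) + (Iₘ i a * Y b j + (- (Iₘ i a * (t * Y b j))) * Y b a)
      ≈⟨ solve 5 (λ Iij Iia t Ybj Yba →
           (con (+ 1) :* Iij :+ (:- (t :* Ybj)) :* Iia) :+ (Iia :* Ybj :+ (:- (Iia :* (t :* Ybj))) :* Yba)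
           := Iij :+ Iia :* Ybj :* (con (+ 1) :- t :* (con (+ 1) :+ Yba)))
           refl (Iₘ i j) (Iₘ i a) t (Y b j) (Y b a) ⟩
    Iₘ i j + Iₘ i a * Y b j * (1# - t * (1# + Y b a))  ≈⟨ +-congˡ (*-congˡ (+-congˡ (-‿cong t[1+Yba]≈1))) ⟩
    Iₘ i j + Iₘ i a * Y b j * (1# - 1#)
      ≈⟨ solve 3 (λ x y z → x :+ y :* z :* (con (+ 1) :- con (+ 1)) := x) refl _ _ _ ⟩
    Iₘ i j ∎

  rankOne-inverseˡ : ∀ {n} (M Y : Mat n) a b t → (Y *ₘ M) ≈ₘ Iₘ → t * (1# + Y b a) ≈ 1# →
    (rankOneInverse Y a b t *ₘ (M +ₘ E a b)) ≈ₘ Iₘ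
  rankOne-inverseˡ {n} M Y a b t YM≈I t[1+Yba]≈1 i j = begin
    Σ[ n ] (λ k → (Y i k - t * (Y i a * Y b k)) * (M k j + Iₘ k a * Iₘ b j))
      ≈⟨ Σ-cong n (λ k → solve 7 (λ Yik t Yia Ybk Mkj Ika Ibj →
           (Yik :- t :* (Yia :* Ybk)) :* (Mkj :+ Ika :* Ibj) :=
           (con (+ 1) :* (Yik :* Mkj) :+ (:- (t :* Yia)) :* (Ybk :* Mkj)) :+
           (Ibj :* (Yik :* Ika) :+ (:- (t :* Yia :* Ibj)) :* (Ybk :* Ika)))
           refl (Y i k) t (Y i a) (Y b k) (M k j) (Iₘ k a) (Iₘ b j)) ⟩
    _ ≈⟨ Σ-linear₄ n 1# (- (t * Y i a)) (Iₘ b j) (- (t * Y i a * Iₘ b j))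
           (λ k → Y i k * M k j) (λ k → Y b k * M k j) (λ k → Y i k * Iₘ k a) (λ k → Y b k * Iₘ k a) ⟩
    (1# * (Y *ₘ M) i j + (- (t * Y i a)) * (Y *ₘ M) b j) +
    (Iₘ b j * Σ[ n ] (λ k → Y i k * Iₘ k a) + (- (t * Y i a * Iₘ b j)) * Σ[ n ] (λ k → Y b k * Iₘ k a))
      ≈⟨ +-cong (+-cong (*-congˡ (YM≈I i j)) (*-congˡ (YM≈I b j)))
                (+-cong (*-congˡ (Σ-Iₘʳ n a (Y i))) (*-congˡ (Σ-Iₘʳ n a (Y b)))) ⟩
    (1# * Iₘ i j + (- (t * Y i a)) * Iₘ b j) + (Iₘ b j * Y i a + (- (t * Y i a * Iₘ b j)) * Y b a)
      ≈⟨ solve 5 (λ Iij Ibj t Yia Yba →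
           (con (+ 1) :* Iij :+ (:- (t :* Yia)) :* Ibj) :+ (Ibj :* Yia :+ (:- (t :* Yia :* Ibj)) :* Yba)
           := Iij :+ Ibj :* Yia :* (con (+ 1) :- t :* (con (+ 1) :+ Yba)))
           refl (Iₘ i j) (Iₘ b j) t (Y i a) (Y b a) ⟩
    Iₘ i j + Iₘ b j * Y i a * (1# - t * (1# + Y b a))  ≈⟨ +-congˡ (*-congˡ (+-congˡ (-‿cong t[1+Yba]≈1))) ⟩
    Iₘ i j + Iₘ b j * Y i a * (1# - 1#)
      ≈⟨ solve 3 (λ x y z → x :+ y :* z :* (con (+ 1) :- con (+ 1)) := x) refl _ _ _ ⟩
    Iₘ i j ∎

  rankOne-invertible : ∀ {n} (M Y : Mat n) a b → (M *ₘ Y) ≈ₘ Iₘ → (Y *ₘ M) ≈ₘ Iₘ →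
    ¬ 1# + Y b a ≈ 0# → IsInvertible (M +ₘ E a b)
  rankOne-invertible M Y a b MY≈I YM≈I 1+Yba≉0 with inverse _ 1+Yba≉0
  ... | t , [1+Yba]t≈1 =
    rankOneInverse Y a b t , rankOne-inverseʳ M Y a b t MY≈I t[1+Yba]≈1 , rankOne-inverseˡ M Y a b t YM≈I t[1+Yba]≈1
    where
    t[1+Yba]≈1 : t * (1# + Y b a) ≈ 1#
    t[1+Yba]≈1 = trans (*-comm _ _) [1+Yba]t≈1

  det₂ : Carrier → Carrier → Carrier → Carrier → Carrier
  det₂ p q r s = p * s - q * r

  adj₂-row₀-leftNull : ∀ p q r s → det₂ p q r s ≈ 0# → s * p + - q * r ≈ 0# × s * q + - q * s ≈ 0#
  adj₂-row₀-leftNull p q r s det≈0 =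
    trans (solve 4 (λ p q r s → s :* p :+ (:- q) :* r := p :* s :- q :* r) refl p q r s) det≈0 ,
    solve 2 (λ q s → s :* q :+ (:- q) :* s := con (+ 0)) refl q s

  adj₂-row₁-leftNull : ∀ p q r s → det₂ p q r s ≈ 0# → - r * p + p * r ≈ 0# × - r * q + p * s ≈ 0#
  adj₂-row₁-leftNull p q r s det≈0 =
    solve 2 (λ p r → (:- r) :* p :+ p :* r := con (+ 0)) refl p r ,
    trans (solve 4 (λ p q r s → (:- r) :* q :+ p :* s := p :* s :- q :* r) refl p q r s) det≈0

  det₂≈0⇒leftNull : ∀ p q r s → det₂ p q r s ≈ 0# →
    ∃₂ λ u v → (¬ u ≈ 0# ⊎ ¬ v ≈ 0#) × u * p + v * r ≈ 0# × u * q + v * s ≈ 0#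
  det₂≈0⇒leftNull p q r s det≈0 with p ≟ 0# | r ≟ 0# | s ≟ 0# | q ≟ 0#
  ... | no p≉0  | _       | _      | _      = - r , p , inj₂ p≉0 , adj₂-row₁-leftNull p q r s det≈0
  ... | _       | no r≉0  | _      | _      = - r , p , inj₁ (-‿nonZero r≉0) , adj₂-row₁-leftNull p q r s det≈0
  ... | _       | _       | no s≉0 | _      = s , - q , inj₁ s≉0 , adj₂-row₀-leftNull p q r s det≈0
  ... | _       | _       | _      | no q≉0 = s , - q , inj₂ (-‿nonZero q≉0) , adj₂-row₀-leftNull p q r s det≈0
  ... | yes p≈0 | yes r≈0 | yes _  | yes q≈0 = 1# , 0# , inj₁ (0≉1 ∘ sym) , e₀-null p≈0 r , e₀-null q≈0 s
    where
    e₀-null : ∀ {x} → x ≈ 0# → ∀ y → 1# * x + 0# * y ≈ 0#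
    e₀-null {x} x≈0 y = trans (solve 2 (λ x y → con (+ 1) :* x :+ con (+ 0) :* y := x) refl x y) x≈0

  rowCombination : ∀ {n} → Carrier → Carrier → Fin n → Fin n → Mat n → Fin n → Carrier
  rowCombination u v b d Y j = u * Y b j + v * Y d j

  rowCombination-*ₘ : ∀ {n} u v (b d : Fin n) (M Y : Mat n) → (Y *ₘ M) ≈ₘ Iₘ →
    ∀ l → Σ[ n ] (λ k → rowCombination u v b d Y k * M k l) ≈ u * Iₘ b l + v * Iₘ d l
  rowCombination-*ₘ {n} u v b d M Y YM≈I l = begin
    Σ[ n ] (λ k → (u * Y b k + v * Y d k) * M k l)
      ≈⟨ Σ-cong n (λ k → solve 5 (λ u y v y′ m → (u :* y :+ v :* y′) :* m := u :* (y :* m) :+ v :* (y′ :* m))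
                                  refl u (Y b k) v (Y d k) (M k l)) ⟩
    Σ[ n ] (λ k → u * (Y b k * M k l) + v * (Y d k * M k l))  ≈⟨ Σ-linear₂ n u v _ _ ⟩
    u * (Y *ₘ M) b l + v * (Y *ₘ M) d l                       ≈⟨ +-cong (*-congˡ (YM≈I b l)) (*-congˡ (YM≈I d l)) ⟩
    u * Iₘ b l + v * Iₘ d l                                   ∎

  rowCombination-leftNull : ∀ {n} u v (a b c d : Fin n) (M Y : Mat n) → (Y *ₘ M) ≈ₘ Iₘ →
    u * (1# + Y b a) + v * Y d a ≈ 0# → u * Y b c + v * (1# + Y d c) ≈ 0# →
    ∀ l → Σ[ n ] (λ k → rowCombination u v b d Y k * (M +ₘ (E a b +ₘ E c d)) k l) ≈ 0#
  rowCombination-leftNull {n} u v a b c d M Y YM≈I column-a column-c l = begin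
    Σ[ n ] (λ k → w k * (M k l + (Iₘ k a * Iₘ b l + Iₘ k c * Iₘ d l)))
      ≈⟨ Σ-cong n (λ k → solve 6 (λ w m ika ibl ikc idl →
           w :* (m :+ (ika :* ibl :+ ikc :* idl)) := w :* m :+ (ibl :* (w :* ika) :+ idl :* (w :* ikc)))
           refl (w k) (M k l) (Iₘ k a) (Iₘ b l) (Iₘ k c) (Iₘ d l)) ⟩
    Σ[ n ] (λ k → w k * M k l + (Iₘ b l * (w k * Iₘ k a) + Iₘ d l * (w k * Iₘ k c)))
      ≈⟨ trans (Σ-distrib-+ n _ _) (+-congˡ (Σ-linear₂ n _ _ _ _)) ⟩
    Σ[ n ] (λ k → w k * M k l) + (Iₘ b l * Σ[ n ] (λ k → w k * Iₘ k a) + Iₘ d l * Σ[ n ] (λ k → w k * Iₘ k c))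
      ≈⟨ +-cong (rowCombination-*ₘ u v b d M Y YM≈I l) (+-cong (*-congˡ (Σ-Iₘʳ n a w)) (*-congˡ (Σ-Iₘʳ n c w))) ⟩
    (u * Iₘ b l + v * Iₘ d l) + (Iₘ b l * w a + Iₘ d l * w c)
      ≈⟨ solve 8 (λ u v ibl idl yba yda ybc ydc →
           (u :* ibl :+ v :* idl) :+ (ibl :* (u :* yba :+ v :* yda) :+ idl :* (u :* ybc :+ v :* ydc)) :=
           ibl :* (u :* (con (+ 1) :+ yba) :+ v :* yda) :+ idl :* (u :* ybc :+ v :* (con (+ 1) :+ ydc)))
           refl u v (Iₘ b l) (Iₘ d l) (Y b a) (Y d a) (Y b c) (Y d c) ⟩
    Iₘ b l * (u * (1# + Y b a) + v * Y d a) + Iₘ d l * (u * Y b c + v * (1# + Y d c))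
      ≈⟨ +-cong (*-congˡ column-a) (*-congˡ column-c) ⟩
    Iₘ b l * 0# + Iₘ d l * 0#
      ≈⟨ solve 2 (λ x y → x :* con (+ 0) :+ y :* con (+ 0) := con (+ 0)) refl _ _ ⟩
    0# ∎
    where
    w = rowCombination u v b d Y

  rankTwo-singular : ∀ {n} (M Y : Mat n) a b c d → b ≢ d → (Y *ₘ M) ≈ₘ Iₘ →
    det₂ (1# + Y b a) (Y b c) (Y d a) (1# + Y d c) ≈ 0# → ¬ IsInvertible (M +ₘ (E a b +ₘ E c d))
  rankTwo-singular {n} M Y a b c d b≢d YM≈I det≈0 inv
    with det₂≈0⇒leftNull _ _ _ _ det≈0
  ... | u , v , u≉0⊎v≉0 , column-a , column-c = [ (λ u≉0 → u≉0 u≈0) , (λ v≉0 → v≉0 v≈0) ]′ u≉0⊎v≉0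
    where
    uIb+vId≈0 : ∀ l → u * Iₘ b l + v * Iₘ d l ≈ 0#
    uIb+vId≈0 l = trans (sym (rowCombination-*ₘ u v b d M Y YM≈I l)) (Σ-zero n (λ k →
      trans (*-congʳ (leftNull⇒zero _ inv (rowCombination-leftNull u v a b c d M Y YM≈I column-a column-c) k))
            (zeroˡ _)))
    u≈0 : u ≈ 0#
    u≈0 = begin
      u                         ≈⟨ solve 2 (λ u v → u := u :* con (+ 1) :+ v :* con (+ 0)) refl u v ⟩
      u * 1# + v * 0#           ≈⟨ +-cong (*-congˡ (Iₘ-diagonal b)) (*-congˡ (Iₘ-offDiagonal (b≢d ∘ ≡.sym))) ⟨
      u * Iₘ b b + v * Iₘ d b   ≈⟨ uIb+vId≈0 b ⟩
      0#                        ∎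
    v≈0 : v ≈ 0#
    v≈0 = begin
      v                         ≈⟨ solve 2 (λ u v → v := u :* con (+ 0) :+ v :* con (+ 1)) refl u v ⟩
      u * 0# + v * 1#           ≈⟨ +-cong (*-congˡ (Iₘ-offDiagonal b≢d)) (*-congˡ (Iₘ-diagonal d)) ⟨
      u * Iₘ b d + v * Iₘ d d   ≈⟨ uIb+vId≈0 d ⟩
      0#                        ∎

module CommonNeighbours {c ℓ} (F : FiniteField c ℓ) (m : ℕ) where
  open FiniteField F
  open Matrices F
  open IntegerCoefficients commRing
  open MatrixAlgebra F
  open import Algebra.Properties.Ring ring using (-0#≈0#)
  open import Relation.Binary.Reasoning.Setoid setoid

  N : ℕ
  N = suc (suc (suc m))

  A₁ A₂ : Mat N
  A₁ = E 0F 1F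
  A₂ = E 0F 1F +ₘ E 1F 2F

  D : Mat N → Carrier
  D Y = det₂ (1# + Y 1F 0F) (Y 1F 1F) (Y 2F 0F) (1# + Y 2F 1F)

  D-cong : ∀ {Y Y′} → Y ≈ₘ Y′ → D Y ≈ D Y′
  D-cong Y≈Y′ = +-cong (*-cong (+-congˡ (Y≈Y′ 1F 0F)) (+-congˡ (Y≈Y′ 2F 1F)))
                       (-‿cong (*-cong (Y≈Y′ 1F 1F) (Y≈Y′ 2F 0F)))

  D-degenerate : ∀ Y → 1# + Y 1F 0F ≈ 0# → D Y ≈ - (Y 2F 0F * Y 1F 1F)
  D-degenerate Y 1+Y₁₀≈0 = begin
    (1# + Y 1F 0F) * (1# + Y 2F 1F) - Y 1F 1F * Y 2F 0F ≈⟨ +-congʳ (*-congʳ 1+Y₁₀≈0) ⟩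
    0# * (1# + Y 2F 1F) - Y 1F 1F * Y 2F 0F
      ≈⟨ solve 3 (λ y₂₁ y₁₁ y₂₀ → con (+ 0) :* (con (+ 1) :+ y₂₁) :- y₁₁ :* y₂₀ := :- (y₂₀ :* y₁₁))
               refl (Y 2F 1F) (Y 1F 1F) (Y 2F 0F) ⟩
    - (Y 2F 0F * Y 1F 1F)                                ∎

  Y₂₀Y₁₁≉0 : ∀ Y → ¬ D Y ≈ 0# → 1# + Y 1F 0F ≈ 0# → ¬ Y 2F 0F * Y 1F 1F ≈ 0#
  Y₂₀Y₁₁≉0 Y D≉0 1+Y₁₀≈0 Y₂₀Y₁₁≈0 = D≉0 (trans (D-degenerate Y 1+Y₁₀≈0) (trans (-‿cong Y₂₀Y₁₁≈0) -0#≈0#))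

  Y₁₁≉0 : ∀ Y → ¬ D Y ≈ 0# → 1# + Y 1F 0F ≈ 0# → ¬ Y 1F 1F ≈ 0#
  Y₁₁≉0 Y D≉0 1+Y₁₀≈0 Y₁₁≈0 = Y₂₀Y₁₁≉0 Y D≉0 1+Y₁₀≈0 (trans (*-congˡ Y₁₁≈0) (zeroʳ _))

  shear : Mat N → Mat N
  shear Y = colShear 1F 0F (Y 2F 0F) Y

  shear₁₁ : ∀ Y → shear Y 1F 1F ≈ Y 1F 1F
  shear₁₁ Y = colShear-≢ 1F 0F (Y 2F 0F) Y 1F 1F (λ ())

  1+shear₁₀ : ∀ Y → 1# + Y 1F 0F ≈ 0# → 1# + shear Y 1F 0F ≈ Y 2F 0F * Y 1F 1F
  1+shear₁₀ Y 1+Y₁₀≈0 = begin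
    1# + shear Y 1F 0F                       ≈⟨ +-congˡ (colShear-target 1F 0F (Y 2F 0F) Y 1F) ⟩
    1# + (Y 1F 0F + Y 2F 0F * Y 1F 1F)       ≈⟨ +-assoc 1# _ _ ⟨
    (1# + Y 1F 0F) + Y 2F 0F * Y 1F 1F       ≈⟨ +-congʳ 1+Y₁₀≈0 ⟩
    0# + Y 2F 0F * Y 1F 1F                   ≈⟨ +-identityˡ _ ⟩
    Y 2F 0F * Y 1F 1F                        ∎

  D-shear : ∀ Y → 1# + Y 1F 0F ≈ 0# → D (shear Y) ≈ 0#
  D-shear Y 1+Y₁₀≈0 = begin
    (1# + shear Y 1F 0F) * (1# + shear Y 2F 1F) - shear Y 1F 1F * shear Y 2F 0F
      ≈⟨ +-cong (*-cong (1+shear₁₀ Y 1+Y₁₀≈0) (+-congˡ (colShear-≢ 1F 0F s Y 2F 1F (λ ()))))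
                (-‿cong (*-cong (shear₁₁ Y) (colShear-target 1F 0F s Y 2F))) ⟩
    (s * Y 1F 1F) * (1# + Y 2F 1F) - Y 1F 1F * (Y 2F 0F + s * Y 2F 1F)
      ≈⟨ solve 3 (λ s y₁₁ y₂₁ → (s :* y₁₁) :* (con (+ 1) :+ y₂₁) :- y₁₁ :* (s :+ s :* y₂₁) := con (+ 0))
               refl s (Y 1F 1F) (Y 2F 1F) ⟩
    0#                                                                           ∎
    where s = Y 2F 0F

  -- When 1 + Y₁₀ ≈ 0, adding Y₂₀ times column 1 of Y to column 0 turns 1 + Y₁₀ into Y₂₀Y₁₁, which
  -- D Y ≉ 0 forces to be nonzero; lift M Y is the matching inverse.
  liftInv : Mat N → Mat N
  liftInv Y with 1# + Y 1F 0F ≟ 0#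
  ... | no _  = Y
  ... | yes _ = shear Y

  lift : Mat N → Mat N → Mat N
  lift M Y with 1# + Y 1F 0F ≟ 0#
  ... | no _  = M
  ... | yes _ = rowShear 1F 0F (Y 2F 0F) M

  lift-inverse : ∀ M Y → (M *ₘ Y) ≈ₘ Iₘ → (Y *ₘ M) ≈ₘ Iₘ →
    (lift M Y *ₘ liftInv Y) ≈ₘ Iₘ × (liftInv Y *ₘ lift M Y) ≈ₘ Iₘ
  lift-inverse M Y MY≈I YM≈I with 1# + Y 1F 0F ≟ 0#
  ... | no _  = MY≈I , YM≈I
  ... | yes _ = shear-inverse 1F 0F (λ ()) (Y 2F 0F) M Y MY≈I YM≈I

  liftInv-A₁ : ∀ Y → ¬ D Y ≈ 0# → ¬ 1# + liftInv Y 1F 0F ≈ 0#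
  liftInv-A₁ Y D≉0 with 1# + Y 1F 0F ≟ 0#
  ... | no 1+Y₁₀≉0 = 1+Y₁₀≉0
  ... | yes 1+Y₁₀≈0 = Y₂₀Y₁₁≉0 Y D≉0 1+Y₁₀≈0 ∘ trans (sym (1+shear₁₀ Y 1+Y₁₀≈0))

  shear-injective : ∀ Y Y′ → ¬ D Y ≈ 0# → 1# + Y 1F 0F ≈ 0# → 1# + Y′ 1F 0F ≈ 0# →
    shear Y ≈ₘ shear Y′ → Y ≈ₘ Y′
  shear-injective Y Y′ D≉0 1+Y₁₀≈0 1+Y′₁₀≈0 eq =
    ≈ₘ-trans (≈ₘ-sym (colShear-cancel (λ ()) (Y 2F 0F) Y))
    (≈ₘ-trans (colShear-cong (-‿cong Y₂₀≈Y′₂₀) eq) (colShear-cancel (λ ()) (Y′ 2F 0F) Y′))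
    where
    Y₁₁≈Y′₁₁ : Y 1F 1F ≈ Y′ 1F 1F
    Y₁₁≈Y′₁₁ = trans (sym (shear₁₁ Y)) (trans (eq 1F 1F) (shear₁₁ Y′))
    Y₂₀≈Y′₂₀ : Y 2F 0F ≈ Y′ 2F 0F
    Y₂₀≈Y′₂₀ = *-cancelʳ-nonZero (Y₁₁≉0 Y D≉0 1+Y₁₀≈0) (begin
      Y 2F 0F * Y 1F 1F      ≈⟨ 1+shear₁₀ Y 1+Y₁₀≈0 ⟨
      1# + shear Y 1F 0F     ≈⟨ +-congˡ (eq 1F 0F) ⟩
      1# + shear Y′ 1F 0F    ≈⟨ 1+shear₁₀ Y′ 1+Y′₁₀≈0 ⟩
      Y′ 2F 0F * Y′ 1F 1F    ≈⟨ *-congˡ Y₁₁≈Y′₁₁ ⟨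
      Y′ 2F 0F * Y 1F 1F     ∎)

  liftInv-injective : ∀ Y Y′ → ¬ D Y ≈ 0# → ¬ D Y′ ≈ 0# → liftInv Y ≈ₘ liftInv Y′ → Y ≈ₘ Y′
  liftInv-injective Y Y′ D≉0 D′≉0 eq with 1# + Y 1F 0F ≟ 0# | 1# + Y′ 1F 0F ≟ 0#
  ... | no _        | no _         = eq
  ... | no _        | yes 1+Y′₁₀≈0 = contradiction (trans (D-cong eq) (D-shear Y′ 1+Y′₁₀≈0)) D≉0
  ... | yes 1+Y₁₀≈0 | no _         = contradiction (trans (D-cong (≈ₘ-sym eq)) (D-shear Y 1+Y₁₀≈0)) D′≉0
  ... | yes 1+Y₁₀≈0 | yes 1+Y′₁₀≈0 = shear-injective Y Y′ D≉0 1+Y₁₀≈0 1+Y′₁₀≈0 eq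

  U U⁻¹ Y₀ M₀ : Mat N
  U   = colShear 1F 2F 1# Iₘ
  U⁻¹ = rowShear 1F 2F 1# Iₘ
  Y₀  = colShear 2F 1F (- 1#) U
  M₀  = rowShear 2F 1F (- 1#) U⁻¹

  U-inverse : (U⁻¹ *ₘ U) ≈ₘ Iₘ × (U *ₘ U⁻¹) ≈ₘ Iₘ
  U-inverse = shear-inverse 1F 2F (λ ()) 1# Iₘ Iₘ (*ₘ-identityˡ Iₘ) (*ₘ-identityˡ Iₘ)

  M₀-inverse : (M₀ *ₘ Y₀) ≈ₘ Iₘ × (Y₀ *ₘ M₀) ≈ₘ Iₘ
  M₀-inverse = shear-inverse 2F 1F (λ ()) (- 1#) U⁻¹ U (proj₁ U-inverse) (proj₂ U-inverse)

  Y₀₁₀≈0 : Y₀ 1F 0F ≈ 0#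
  Y₀₁₀≈0 = trans (colShear-≢ 2F 1F (- 1#) U 1F 0F (λ ())) (colShear-≢ 1F 2F 1# (Iₘ {N}) 1F 0F (λ ()))

  Y₀₂₀≈0 : Y₀ 2F 0F ≈ 0#
  Y₀₂₀≈0 = trans (colShear-≢ 2F 1F (- 1#) U 2F 0F (λ ())) (colShear-≢ 1F 2F 1# (Iₘ {N}) 2F 0F (λ ()))

  Y₀₁₁≈0 : Y₀ 1F 1F ≈ 0#
  Y₀₁₁≈0 = begin
    Y₀ 1F 1F                  ≈⟨ colShear-target 2F 1F (- 1#) U 1F ⟩
    U 1F 1F + - 1# * U 1F 2F  ≈⟨ +-cong (colShear-≢ 1F 2F 1# (Iₘ {N}) 1F 1F (λ ()))
                                        (*-congˡ (colShear-target 1F 2F 1# (Iₘ {N}) 1F)) ⟩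
    1# + - 1# * (0# + 1# * 1#)
      ≈⟨ solve 0 (con (+ 1) :+ con -[1+ 0 ] :* (con (+ 0) :+ con (+ 1) :* con (+ 1)) := con (+ 0)) refl ⟩
    0#                        ∎

  Y₀₂₁≈-1 : Y₀ 2F 1F ≈ - 1#
  Y₀₂₁≈-1 = begin
    Y₀ 2F 1F                  ≈⟨ colShear-target 2F 1F (- 1#) U 2F ⟩
    U 2F 1F + - 1# * U 2F 2F  ≈⟨ +-cong (colShear-≢ 1F 2F 1# (Iₘ {N}) 2F 1F (λ ()))
                                        (*-congˡ (colShear-target 1F 2F 1# (Iₘ {N}) 2F)) ⟩
    0# + - 1# * (1# + 1# * 0#)
      ≈⟨ solve 0 (con (+ 0) :+ con -[1+ 0 ] :* (con (+ 1) :+ con (+ 1) :* con (+ 0)) := con -[1+ 0 ]) refl ⟩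
    - 1#                      ∎

  D-Y₀ : D Y₀ ≈ 0#
  D-Y₀ = begin
    D Y₀  ≈⟨ +-cong (*-cong (+-congˡ Y₀₁₀≈0) (+-congˡ Y₀₂₁≈-1)) (-‿cong (*-cong Y₀₁₁≈0 Y₀₂₀≈0)) ⟩
    (1# + 0#) * (1# + - 1#) - 0# * 0#
      ≈⟨ solve 0 ((con (+ 1) :+ con (+ 0)) :* (con (+ 1) :+ con -[1+ 0 ]) :- con (+ 0) :* con (+ 0) := con (+ 0)) refl ⟩
    0#    ∎

  1+Y₀₁₀≉0 : ¬ 1# + Y₀ 1F 0F ≈ 0#
  1+Y₀₁₀≉0 1+Y₀₁₀≈0 = 0≉1 (sym (trans (sym (+-identityʳ 1#)) (trans (+-congˡ (sym Y₀₁₀≈0)) 1+Y₀₁₀≈0)))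

  liftInv≉Y₀ : ∀ Y → ¬ D Y ≈ 0# → ¬ liftInv Y ≈ₘ Y₀
  liftInv≉Y₀ Y D≉0 eq with 1# + Y 1F 0F ≟ 0#
  ... | no _        = D≉0 (trans (D-cong eq) D-Y₀)
  ... | yes 1+Y₁₀≈0 = Y₁₁≉0 Y D≉0 1+Y₁₀≈0 (trans (sym (shear₁₁ Y)) (trans (eq 1F 1F) Y₀₁₁≈0))

  CommonNeighbour : Mat N → Mat N → Set (c ⊔ ℓ)
  CommonNeighbour A Z = CayAdj 0ₘ Z × CayAdj A Z

  commonNeighbour-A₂⇒D≉0 : ∀ Z (Z~ : CommonNeighbour A₂ Z) → ¬ D (proj₁ (proj₁ Z~)) ≈ 0#
  commonNeighbour-A₂⇒D≉0 Z ((Y , _ , YM≈I) , A₂~Z) D≈0 =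
    rankTwo-singular (0ₘ -ₘ Z) Y 0F 1F 1F 2F (λ ()) YM≈I D≈0 (CayAdj⇒invertible A₂ Z A₂~Z)

  lifted : ∀ Z → CommonNeighbour A₂ Z → Mat N
  lifted Z ((Y , _) , _) = 0ₘ -ₘ lift (0ₘ -ₘ Z) Y

  lifted-commonNeighbour : ∀ Z Z~ → CommonNeighbour A₁ (lifted Z Z~)
  lifted-commonNeighbour Z Z~@((Y , MY≈I , YM≈I) , _) =
    IsInvertible-resp (≈ₘ-sym (0ₘ-ₘ-involutive L)) (liftInv Y , L-inverse) ,
    invertible⇒CayAdj A₁ L (rankOne-invertible L (liftInv Y) 0F 1F (proj₁ L-inverse) (proj₂ L-inverse)
                                               (liftInv-A₁ Y (commonNeighbour-A₂⇒D≉0 Z Z~)))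
    where
    L = lift (0ₘ -ₘ Z) Y
    L-inverse = lift-inverse (0ₘ -ₘ Z) Y MY≈I YM≈I

  lifted-injective : ∀ Z Z′ Z~ Z′~ → lifted Z Z~ ≈ₘ lifted Z′ Z′~ → Z ≈ₘ Z′
  lifted-injective Z Z′ Z~@((Y , MY≈I , YM≈I) , _) Z′~@((Y′ , M′Y′≈I , Y′M′≈I) , _) eq =
    0ₘ-ₘ-injective (inverse-unique Y≈Y′ YM≈I M′Y′≈I)
    where
    liftInv-≈ : liftInv Y ≈ₘ liftInv Y′
    liftInv-≈ = inverse-unique (0ₘ-ₘ-injective eq) (proj₁ (lift-inverse (0ₘ -ₘ Z) Y MY≈I YM≈I))
                                                 (proj₂ (lift-inverse (0ₘ -ₘ Z′) Y′ M′Y′≈I Y′M′≈I))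
    Y≈Y′ : Y ≈ₘ Y′
    Y≈Y′ = liftInv-injective Y Y′ (commonNeighbour-A₂⇒D≉0 Z Z~) (commonNeighbour-A₂⇒D≉0 Z′ Z′~) liftInv-≈

  Z₀ : Mat N
  Z₀ = 0ₘ -ₘ M₀

  Z₀-commonNeighbour : CommonNeighbour A₁ Z₀
  Z₀-commonNeighbour =
    IsInvertible-resp (≈ₘ-sym (0ₘ-ₘ-involutive M₀)) (Y₀ , M₀-inverse) ,
    invertible⇒CayAdj A₁ M₀ (rankOne-invertible M₀ Y₀ 0F 1F (proj₁ M₀-inverse) (proj₂ M₀-inverse) 1+Y₀₁₀≉0)

  lifted≉Z₀ : ∀ Z Z~ → ¬ lifted Z Z~ ≈ₘ Z₀
  lifted≉Z₀ Z Z~@((Y , MY≈I , YM≈I) , _) eq = liftInv≉Y₀ Y (commonNeighbour-A₂⇒D≉0 Z Z~)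
    (inverse-unique (0ₘ-ₘ-injective eq) (proj₁ (lift-inverse (0ₘ -ₘ Z) Y MY≈I YM≈I)) (proj₂ M₀-inverse))

  commonNeighbours-A₂<A₁ : ∀ {k l} → HasSize (MatSetoid N) (CommonNeighbour A₂) k →
    HasSize (MatSetoid N) (CommonNeighbour A₁) l → k < l
  commonNeighbours-A₂<A₁ size₂ size₁ = HasSize-<-byInjection (MatSetoid N) size₂ size₁
    lifted lifted-commonNeighbour lifted-injective Z₀ Z₀-commonNeighbour lifted≉Z₀

  0≉A₁ : ¬ 0ₘ ≈ₘ A₁
  0≉A₁ 0≈A₁ = 0≉1 (trans (0≈A₁ 0F 1F) (*-identityˡ 1#))

  0≉A₂ : ¬ 0ₘ ≈ₘ A₂
  0≉A₂ 0≈A₂ = 0≉1 (trans (0≈A₂ 0F 1F)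
    (solve 0 (con (+ 1) :* con (+ 1) :+ con (+ 0) :* con (+ 0) := con (+ 1)) refl))

  0≁A₁ : ¬ CayAdj 0ₘ A₁
  0≁A₁ = zeroRow⇒singular (0ₘ -ₘ A₁) 2F (λ j →
    solve 1 (λ x → con (+ 0) :- con (+ 0) :* x := con (+ 0)) refl (Iₘ 1F j))

  0≁A₂ : ¬ CayAdj 0ₘ A₂
  0≁A₂ = zeroRow⇒singular (0ₘ -ₘ A₂) 2F (λ j →
    solve 2 (λ x y → con (+ 0) :- (con (+ 0) :* x :+ con (+ 0) :* y) := con (+ 0)) refl (Iₘ 1F j) (Iₘ 2F j))

mainTheorem2 : ∀ {c ℓ} (F : FiniteField c ℓ) (n : ℕ) → n > 2 →
    ¬ (∃ λ v → ∃ λ k → ∃ λ λ' → ∃ λ μ →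
        IsStronglyRegular (Matrices.MatSetoid F n) (Matrices.CayAdj F) v k λ' μ)
mainTheorem2 F (suc (suc (suc m))) _ (_ , _ , _ , _ , _ , _ , _ , nonAdjacent-μ) =
  ℕ.<-irrefl ≡.refl
    (commonNeighbours-A₂<A₁ (nonAdjacent-μ 0ₘ A₂ 0≉A₂ 0≁A₂) (nonAdjacent-μ 0ₘ A₁ 0≉A₁ 0≁A₁))
  where
  open MatrixAlgebra F
  open CommonNeighbours F m
mainTheorem2 F 0 ()
mainTheorem2 F 1 (s≤s ())
mainTheorem2 F 2 (s≤s (s≤s ()))
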